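{- Let $n$ be a natural number. Every partition of $n$ into pairwise distinct parts is represented by some tuple belonging to the complete set of descending jumps with invariant initial term $a_1$ and unequal terms, for some $a_1\in\{1,2,\dots,n\}$.
   Context: Partitions are written as finite ordered tuples of positive integers. A jump with invariant initial term $a_1$ and order $r$ transforms a tuple $(a_1,a_2,\dots,a_m)$ of pairwise distinct terms into $(a_1,\,r,\,a_2,\dots,a_m)$, provided $r$ is less than every term of the tuple and $a_1$ is greater than the last term of the resulting tuple. A sequence of descending jumps with invariant initial term $a_1$ and unequal terms is a succession of such jumps, starting from the one-term tuple $(a_1)$, whose orders form a strictly decreasing sequence. The complete set of descending jumps with invariant initial term $a_1$ and unequal terms is the set of all tuples obtained from $(a_1)$ by all possible such sequences (including the empty one, giving $(a_1)$ itself). -}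

module Defs where

open import Data.Nat using (ℕ; _<_; _>_)
open import Data.List using (List; []; _∷_; last)
open import Data.Nat.ListAction using (sum)
open import Data.Maybe using (just)
open import Data.Product using (Σ; ∃; _×_)
open import Data.List.Relation.Unary.All using (All)
open import Data.List.Relation.Unary.Unique.Propositional using (Unique)
open import Data.List.Relation.Unary.Linked using (Linked)
open import Relation.Binary.PropositionalEquality using (_≡_)

LastBelow : ℕ → List ℕ → Set
LastBelow a₁ t = ∀ x → last t ≡ just x → x < a₁

Jump : ℕ → ℕ → List ℕ → List ℕ → Set
Jump a₁ r t t' =
  Σ (List ℕ) λ rest →
    (t ≡ a₁ ∷ rest) × (t' ≡ a₁ ∷ r ∷ rest) ×
    Unique t × All (r <_) t × LastBelow a₁ t'

-- DescJumps a₁ os t : starting from (a₁), the sequence of jumps with orders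
-- os (most recent first; strictly decreasing in chronological order) yields t.
data DescJumps (a₁ : ℕ) : List ℕ → List ℕ → Set where
  start : DescJumps a₁ [] (a₁ ∷ [])
  jump  : ∀ {os t t'} (r : ℕ) → DescJumps a₁ os t → All (r <_) os →
          Jump a₁ r t t' → DescJumps a₁ (r ∷ os) t'

CompleteDescJumps : ℕ → List ℕ → Set
CompleteDescJumps a₁ t = ∃ λ os → DescJumps a₁ os t

DistinctPartition : ℕ → List ℕ → Set
DistinctPartition n p = All (0 <_) p × Linked _>_ p × (sum p ≡ n)

{-# OPTIONS --safe #-}
module Submission where

-- A distinct partition a₁ > a₂ > ⋯ > aₘ arises from (a₁) by the jumps of
-- orders a₂, a₃, …, aₘ in this order: every jump inserts a part smaller
-- than all parts present so far, directly after a₁.  The resulting tuple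
-- (a₁, aₘ, …, a₂) is a₁ followed by the remaining parts sorted ascending.

open import Defs
open import Data.Nat using (ℕ; _≤_; _<_; _>_)
open import Data.Nat.Properties using (≤-trans; <-trans; <⇒≢; >⇒≢; ≤∧≢⇒<; m≤m+n; ≤-decTotalOrder)
open import Data.List using (List; []; _∷_)
open import Data.Product using (∃; _×_; _,_; uncurry)
open import Data.List.Relation.Unary.All as All using (All; []; _∷_)
open import Data.List.Relation.Unary.AllPairs as AllPairs using (AllPairs; []; _∷_)
open import Data.List.Relation.Unary.Linked using (Linked)
open import Data.List.Relation.Unary.Linked.Properties using (Linked⇒AllPairs)
open import Data.List.Relation.Unary.Unique.Propositional using (Unique)
open import Data.List.Relation.Binary.Permutation.Propositional using (_↭_; ↭-sym; prep; ↭⇒↭ₛ)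
open import Data.List.Relation.Binary.Permutation.Propositional.Properties using (All-resp-↭)
import Data.List.Relation.Binary.Permutation.Setoid.Properties as Permutationₛ
open import Data.List.Sort ≤-decTotalOrder using (sort; sort-↭; sort-↗)
open import Relation.Binary.PropositionalEquality using (refl; setoid)

lastBelow-all : ∀ {a₁ t} → All (_< a₁) t → LastBelow a₁ t
lastBelow-all (x<a₁ ∷ [])         x refl = x<a₁
lastBelow-all (_ ∷ rest@(_ ∷ _)) x eq   = lastBelow-all rest x eq

unique-resp-↭ : {xs ys : List ℕ} → xs ↭ ys → Unique xs → Unique ys
unique-resp-↭ xs↭ys = Permutationₛ.Unique-resp-↭ (setoid ℕ) (↭⇒↭ₛ xs↭ys)

sorted∧unique⇒strictlyIncreasing : {xs : List ℕ} → Linked _≤_ xs → Unique xs → AllPairs _<_ xs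
sorted∧unique⇒strictlyIncreasing sorted unique =
  AllPairs.zipWith (uncurry ≤∧≢⇒<) (Linked⇒AllPairs ≤-trans sorted , unique)

descJumps-increasing : ∀ {a₁ os} → AllPairs _<_ os → All (_< a₁) os → DescJumps a₁ os (a₁ ∷ os)
descJumps-increasing []                  []               = start
descJumps-increasing (o<os ∷ increasing) (o<a₁ ∷ os<a₁) =
  jump _ (descJumps-increasing increasing os<a₁) o<os
    (_ , refl , refl , distinct , o<a₁ ∷ o<os , lastBelow-all (o<a₁ ∷ os<a₁))
  where
  distinct : Unique (_ ∷ _)
  distinct = All.map >⇒≢ os<a₁ ∷ AllPairs.map <⇒≢ increasing

completeDescJumps-sortTail : ∀ {a₁ rest} → Linked _>_ (a₁ ∷ rest) → CompleteDescJumps a₁ (a₁ ∷ sort rest)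
completeDescJumps-sortTail {a₁} {rest} decreasing with Linked⇒AllPairs (λ x>y y>z → <-trans y>z x>y) decreasing
... | rest<a₁ ∷ rest-decreasing =
  sort rest , descJumps-increasing (sorted∧unique⇒strictlyIncreasing (sort-↗ rest) sorted-distinct) sorted<a₁
  where
  sorted<a₁ : All (_< a₁) (sort rest)
  sorted<a₁ = All-resp-↭ (↭-sym (sort-↭ rest)) rest<a₁

  sorted-distinct : Unique (sort rest)
  sorted-distinct = unique-resp-↭ (↭-sym (sort-↭ rest)) (AllPairs.map >⇒≢ rest-decreasing)

mainTheorem6 : (n : ℕ) → 1 ≤ n → (p : List ℕ) → DistinctPartition n p →
    ∃ λ a₁ → (1 ≤ a₁) × (a₁ ≤ n) ×
      ∃ λ t → CompleteDescJumps a₁ t × (t ↭ p)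
mainTheorem6 _ () [] (_ , _ , refl)
mainTheorem6 _ _ (a₁ ∷ rest) (a₁>0 ∷ _ , decreasing , refl) =
  a₁ , a₁>0 , m≤m+n a₁ _ ,
  a₁ ∷ sort rest , completeDescJumps-sortTail decreasing , prep a₁ (sort-↭ rest)
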